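{- Let $m\geq 2$ be an integer, let $q$ be a prime power with $q\geq 5$, let $s$ be an integer with $1\leq s\leq q-4$, and let $f\in R_q((m-1)(q-1)+s,m)$ satisfy $|f|=q-s+1$. Then the support of $f$ is contained in an affine line of $\mathbb{F}_q^m$.
   Context: $\mathbb{F}_q$ is the finite field with $q$ elements and $B_m^q$ is the $\mathbb{F}_q$-algebra of all functions $\mathbb{F}_q^m\to\mathbb{F}_q$. Every $f\in B_m^q$ is given by a unique polynomial in $\mathbb{F}_q[X_1,\ldots,X_m]$ of degree at most $q-1$ in each variable (its reduced form), and $\deg(f)$ is the total degree of this reduced form. For $0\leq r\leq m(q-1)$, the generalized Reed–Muller code is $R_q(r,m)=\{f\in B_m^q:\deg(f)\leq r\}$. The support of $f$ is $\{x\in\mathbb{F}_q^m: f(x)\neq 0\}$ and $|f|$ denotes its cardinality (the Hamming weight of $f$). -}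

module Defs where

open import Level using (0ℓ)
open import Data.Nat using (ℕ; zero; suc; _≤_; _∸_)
import Data.Nat
open import Data.Fin using (Fin; zero; suc)
open import Data.List using (List; []; _∷_; length; filter; map; concatMap; foldr)
open import Data.Product using (Σ; ∃; _×_; _,_; proj₁; proj₂)
open import Data.Empty using (⊥)
open import Relation.Nullary using (¬_; ¬?)
open import Relation.Binary.PropositionalEquality using (_≡_; _≢_)
open import Relation.Binary.Definitions using (DecidableEquality)
open import Algebra.Structures using (IsCommutativeRing)
open import Function.Bundles using (_↔_; Inverse)

record FiniteField : Set₁ where
  field
    Carrier : Set
    _+_ _*_ : Carrier → Carrier → Carrier
    -_      : Carrier → Carrier
    0# 1#   : Carrier
    isCommutativeRing : IsCommutativeRing _≡_ _+_ _*_ -_ 0# 1#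
    0≢1     : 0# ≢ 1#
    inverse : ∀ x → x ≢ 0# → ∃ λ y → x * y ≡ 1#
    _≟_     : DecidableEquality Carrier
    size    : ℕ
    enum    : Fin size ↔ Carrier

module _ (F : FiniteField) where
  open FiniteField F

  Point : ℕ → Set
  Point m = Fin m → Carrier

  Fun : ℕ → Set
  Fun m = Point m → Carrier

  pow : Carrier → ℕ → Carrier
  pow x zero    = 1#
  pow x (suc n) = x * pow x n

  prodFin : (m : ℕ) → (Fin m → Carrier) → Carrier
  prodFin zero    g = 1#
  prodFin (suc m) g = g zero * prodFin m (λ i → g (suc i))

  sumFin : (m : ℕ) → (Fin m → ℕ) → ℕ
  sumFin zero    g = zero
  sumFin (suc m) g = g zero Data.Nat.+ sumFin m (λ i → g (suc i))

  Poly : ℕ → Set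
  Poly m = List (Carrier × (Fin m → ℕ))

  evalPoly : (m : ℕ) → Poly m → Point m → Carrier
  evalPoly m p x = foldr (λ t acc → (proj₁ t * prodFin m (λ i → pow (x i) (proj₂ t i))) + acc) 0# p

  data AllTerms {m : ℕ} (P : Carrier × (Fin m → ℕ) → Set) : Poly m → Set where
    []  : AllTerms P []
    _∷_ : ∀ {t p} → P t → AllTerms P p → AllTerms P (t ∷ p)

  Reduced : (m : ℕ) → Poly m → Set
  Reduced m = AllTerms (λ t → ∀ i → proj₂ t i ≤ size ∸ 1)

  DegAtMost : (m r : ℕ) → Poly m → Set
  DegAtMost m r = AllTerms (λ t → sumFin m (proj₂ t) ≤ r)

  InRM : (r m : ℕ) → Fun m → Set
  InRM r m f = Σ (Poly m) λ p → Reduced m p × DegAtMost m r p × (∀ x → f x ≡ evalPoly m p x)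

  allIdx : (m : ℕ) → List (Fin m → Fin size)
  allIdx zero    = (λ ()) ∷ []
  allIdx (suc m) = concatMap (λ a → map (λ v → λ { zero → a ; (suc i) → v i }) (allIdx m)) (allFin′ size)
    where
    allFin′ : (n : ℕ) → List (Fin n)
    allFin′ zero    = []
    allFin′ (suc n) = zero ∷ map suc (allFin′ n)

  weight : (m : ℕ) → Fun m → ℕ
  weight m f = length (filter (λ v → ¬? (f (λ i → Inverse.to enum (v i)) ≟ 0#)) (allIdx m))

  SupportInLine : (m : ℕ) → Fun m → Set
  SupportInLine m f = Σ (Point m) λ a → Σ (Point m) λ v →
    (∃ λ i → v i ≢ 0#) ×
    (∀ x → f x ≢ 0# → ∃ λ t → ∀ i → x i ≡ a i + (t * v i))

-- Summing over F_q^m kills every polynomial function of degree < m(q-1), because the power sums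
-- ∑_{t ∈ F_q} t^k vanish for k < q-1. So if affine forms ℓ₁,…,ℓₙ vanish on the support S of f except
-- at one point p, then ∑ₓ f(x)ℓ₁(x)⋯ℓₙ(x) = f(p)ℓ₁(p)⋯ℓₙ(p) ≠ 0 and deg f + n ≥ m(q-1).
-- If S (of size q-s+1) is not contained in a line, it has three non-collinear points a, b, c; together
-- with two further points d, e of S, some p ∈ {a, b, c} is avoided by two lines covering the other four
-- of these five points. Adding one hyperplane through each remaining point of S gives n = q-s-2 forms,
-- and (m-1)(q-1) + s + (q-s-2) < m(q-1) contradicts the bound.
module Submission where

open import Defs
open import Level using (0ℓ)
open import Algebra.Bundles using (CommutativeRing)
open import Data.Nat as ℕ using (ℕ; zero; suc; _≤_; _<_; _∸_; s≤s; z≤n)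
import Data.Nat.Properties as ℕ
open import Data.Nat.Tactic.RingSolver using (solve-∀)
open import Data.Integer as ℤ using (ℤ; -[1+_])
import Data.Integer.Properties as ℤ
import Data.Sign as Sign
open import Data.Maybe using (Maybe; just; nothing)
open import Data.Fin as Fin using (Fin; zero; suc)
import Data.Fin.Properties as Fin
open import Data.Fin.Permutation using (Permutation)
import Data.Vec.Functional as Vector
open Vector using (Vector)
open import Data.Vec using (Vec; []; _∷_)
open import Data.List as List using (List; []; _∷_; length; tabulate)
import Data.List.Properties as List
open import Data.List.Relation.Unary.All as All using (All; []; _∷_)
import Data.List.Relation.Unary.All.Properties as All
open import Data.List.Relation.Unary.Any as Any using (Any; here; there)
import Data.List.Relation.Unary.Any.Properties as Any
open import Data.List.Relation.Unary.AllPairs as AllPairs using (AllPairs; []; _∷_)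
import Data.List.Relation.Unary.AllPairs.Properties as AllPairs
open import Data.List.Relation.Unary.Unique.Propositional using (Unique)
import Data.List.Relation.Unary.Unique.Propositional.Properties as Unique
import Data.List.Relation.Unary.Unique.Setoid.Properties as UniqueS
open import Data.List.Membership.Propositional using (_∈_)
open import Data.List.Membership.Propositional.Properties using (∈-allFin)
open import Data.List.Membership.Setoid.Properties using (∈-cartesianProductWith⁺)
open import Data.Product using (Σ; ∃; ∃₂; _×_; _,_; proj₁; proj₂; uncurry)
import Data.Sum
open Data.Sum using (_⊎_; inj₁; inj₂)
open import Data.Empty using (⊥-elim)
open import Function.Base using (_∘_)
open import Function.Bundles using (Inverse; _↔_; mk↔ₛ′)
open import Function.Construct.Composition using (_↔-∘_)
open import Function.Construct.Symmetry using (↔-sym)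
open import Relation.Nullary using (¬_; Dec; yes; no; ¬?)
open import Relation.Nullary.Decidable using (_×-dec_)
import Relation.Binary.PropositionalEquality as ≡
open ≡ using (_≡_; _≢_; refl; sym; trans; cong; cong₂; subst; _≗_; module ≡-Reasoning)

-- ℤ maps into every commutative ring, so it can serve as the coefficient ring of Algebra.Solver.Ring.
module IntegerCoefficients {c ℓ} (R : CommutativeRing c ℓ) where
  open CommutativeRing R renaming (refl to ≈-refl; sym to ≈-sym; trans to ≈-trans)
  open import Algebra.Properties.Ring ring using (-0#≈0#; -‿involutive; -‿distribˡ-*; -‿distribʳ-*; -‿+-comm)
  open import Algebra.Properties.CommutativeSemigroup +-commutativeSemigroup using (interchange)
  open import Algebra.Properties.Semiring.Mult semiring using (×-homo-+; ×1-homo-*) renaming (_×_ to _·_)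
  open import Algebra.Solver.Ring.AlmostCommutativeRing
    using (_-Raw-AlmostCommutative⟶_; fromCommutativeRing)
  open import Relation.Binary.Reasoning.Setoid setoid

  ⟦_⟧ : ℤ → Carrier
  ⟦ ℤ.+ n ⟧ = n · 1#
  ⟦ -[1+ n ] ⟧ = - (suc n · 1#)

  ⟦⊖⟧ : ∀ m n → ⟦ m ℤ.⊖ n ⟧ ≈ m · 1# - n · 1#
  ⟦⊖⟧ zero zero = ≈-sym (-‿inverseʳ 0#)
  ⟦⊖⟧ zero (suc n) = ≈-sym (+-identityˡ _)
  ⟦⊖⟧ (suc m) zero = begin
    suc m · 1#            ≈⟨ +-identityʳ _ ⟨
    suc m · 1# + 0#       ≈⟨ +-congˡ -0#≈0# ⟨
    suc m · 1# - 0 · 1#   ∎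
  ⟦⊖⟧ (suc m) (suc n) = begin
    ⟦ suc m ℤ.⊖ suc n ⟧                  ≡⟨ cong ⟦_⟧ (ℤ.[1+m]⊖[1+n]≡m⊖n m n) ⟩
    ⟦ m ℤ.⊖ n ⟧                          ≈⟨ ⟦⊖⟧ m n ⟩
    m · 1# - n · 1#                      ≈⟨ +-identityˡ _ ⟨
    0# + (m · 1# - n · 1#)               ≈⟨ +-congʳ (-‿inverseʳ 1#) ⟨
    (1# - 1#) + (m · 1# - n · 1#)        ≈⟨ interchange 1# (m · 1#) (- 1#) (- (n · 1#)) ⟨
    suc m · 1# + (- 1# - n · 1#)         ≈⟨ +-congˡ (-‿+-comm 1# (n · 1#)) ⟩
    suc m · 1# - suc n · 1#              ∎

  ⟦+⟧ : ∀ i j → ⟦ i ℤ.+ j ⟧ ≈ ⟦ i ⟧ + ⟦ j ⟧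
  ⟦+⟧ (ℤ.+ m) (ℤ.+ n) = ×-homo-+ 1# m n
  ⟦+⟧ (ℤ.+ m) -[1+ n ] = ⟦⊖⟧ m (suc n)
  ⟦+⟧ -[1+ m ] (ℤ.+ n) = ≈-trans (⟦⊖⟧ n (suc m)) (+-comm _ _)
  ⟦+⟧ -[1+ m ] -[1+ n ] = begin
    - (suc (suc (m ℕ.+ n)) · 1#)            ≡⟨ cong (λ k → - (suc k · 1#)) (ℕ.+-suc m n) ⟨
    - ((suc m ℕ.+ suc n) · 1#)              ≈⟨ -‿cong (×-homo-+ 1# (suc m) (suc n)) ⟩
    - (suc m · 1# + suc n · 1#)             ≈⟨ -‿+-comm _ _ ⟨
    - (suc m · 1#) - suc n · 1#             ∎

  ⟦-⟧ : ∀ i → ⟦ ℤ.- i ⟧ ≈ - ⟦ i ⟧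
  ⟦-⟧ (ℤ.+ zero) = ≈-sym -0#≈0#
  ⟦-⟧ (ℤ.+ suc n) = ≈-refl
  ⟦-⟧ -[1+ n ] = ≈-sym (-‿involutive _)

  ⟦+◃⟧ : ∀ n → ⟦ Sign.+ ℤ.◃ n ⟧ ≈ n · 1#
  ⟦+◃⟧ zero = ≈-refl
  ⟦+◃⟧ (suc n) = ≈-refl

  ⟦-◃⟧ : ∀ n → ⟦ Sign.- ℤ.◃ n ⟧ ≈ - (n · 1#)
  ⟦-◃⟧ zero = ≈-sym -0#≈0#
  ⟦-◃⟧ (suc n) = ≈-refl

  ⟦*⟧ : ∀ i j → ⟦ i ℤ.* j ⟧ ≈ ⟦ i ⟧ * ⟦ j ⟧
  ⟦*⟧ (ℤ.+ m) (ℤ.+ n) = ≈-trans (⟦+◃⟧ (m ℕ.* n)) (×1-homo-* m n)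
  ⟦*⟧ (ℤ.+ m) -[1+ n ] = begin
    ⟦ Sign.- ℤ.◃ (m ℕ.* suc n) ⟧    ≈⟨ ⟦-◃⟧ (m ℕ.* suc n) ⟩
    - ((m ℕ.* suc n) · 1#)          ≈⟨ -‿cong (×1-homo-* m (suc n)) ⟩
    - (m · 1# * suc n · 1#)         ≈⟨ -‿distribʳ-* _ _ ⟩
    m · 1# * - (suc n · 1#)         ∎
  ⟦*⟧ -[1+ m ] (ℤ.+ n) = begin
    ⟦ Sign.- ℤ.◃ (suc m ℕ.* n) ⟧    ≈⟨ ⟦-◃⟧ (suc m ℕ.* n) ⟩
    - ((suc m ℕ.* n) · 1#)          ≈⟨ -‿cong (×1-homo-* (suc m) n) ⟩
    - (suc m · 1# * n · 1#)         ≈⟨ -‿distribˡ-* _ _ ⟩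
    - (suc m · 1#) * n · 1#         ∎
  ⟦*⟧ -[1+ m ] -[1+ n ] = begin
    ⟦ Sign.+ ℤ.◃ (suc m ℕ.* suc n) ⟧   ≈⟨ ⟦+◃⟧ (suc m ℕ.* suc n) ⟩
    (suc m ℕ.* suc n) · 1#             ≈⟨ ×1-homo-* (suc m) (suc n) ⟩
    a * b                              ≈⟨ -‿involutive _ ⟨
    - - (a * b)                        ≈⟨ -‿cong (-‿distribʳ-* a b) ⟩
    - (a * - b)                        ≈⟨ -‿distribˡ-* a (- b) ⟩
    - a * - b                          ∎
    where
    a = suc m · 1#
    b = suc n · 1#

  ⟦⟧-morphism : ℤ.+-*-rawRing -Raw-AlmostCommutative⟶ fromCommutativeRing R
  ⟦⟧-morphism = record
    { ⟦_⟧ = ⟦_⟧ ; +-homo = ⟦+⟧ ; *-homo = ⟦*⟧ ; -‿homo = ⟦-⟧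
    ; 0-homo = ≈-refl ; 1-homo = +-identityʳ 1# }

  ⟦⟧-≟ : ∀ i j → Maybe (⟦ i ⟧ ≈ ⟦ j ⟧)
  ⟦⟧-≟ i j with i ℤ.≟ j
  ... | yes ≡.refl = just ≈-refl
  ... | no _ = nothing

  open import Algebra.Solver.Ring ℤ.+-*-rawRing (fromCommutativeRing R) ⟦⟧-morphism ⟦⟧-≟ public
    using (Polynomial; solve; _:=_; _:+_; _:*_; :-_; _:-_; con)

  :0 : ∀ {n} → Polynomial n
  :0 = con (ℤ.+ 0)

module _ {a ℓ} {A : Set a} {P : A → Set ℓ} where

  All-extract : ∀ {q} {Q : A → Set q} {xs} (i : Any P xs) → All Q xs → All Q (Any.lookup i ∷ (xs Any.─ i))
  All-extract i qs = proj₁ (All.lookupAny qs i) ∷ All.─⁺ i qs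

  Any-extract : ∀ {q} {Q : A → Set q} {xs} (i : Any P xs) → Any Q xs → Any Q (Any.lookup i ∷ (xs Any.─ i))
  Any-extract (here _) (here q) = here q
  Any-extract (here _) (there q) = there q
  Any-extract (there i) (here q) = there (here q)
  Any-extract (there i) (there q) with Any-extract i q
  ... | here q′ = here q′
  ... | there q′ = there (there q′)

  AllPairs-extract : ∀ {r} {R : A → A → Set r} → (∀ {x y} → R x y → R y x) →
    ∀ {xs} (i : Any P xs) → AllPairs R xs → AllPairs R (Any.lookup i ∷ (xs Any.─ i))
  AllPairs-extract sym (here _) rs = rs
  AllPairs-extract sym (there i) (r ∷ rs) with AllPairs-extract sym i rs
  ... | c-rs ∷ rs′ = (sym (proj₁ (All.lookupAny r i)) ∷ c-rs) ∷ All.─⁺ i r ∷ rs′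

4≤q∸s : ∀ {q s} → 4 ≤ q → s ≤ q ∸ 4 → 4 ≤ q ∸ s
4≤q∸s {q} {s} 4≤q s≤q∸4 = ℕ.m+n≤o⇒m≤o∸n 4 (subst (_≤ q) (ℕ.+-comm s 4) (ℕ.m≤o∸n⇒m+n≤o s 4≤q s≤q∸4))

q∸s+1≡5+[q∸s∸4] : ∀ {q s} → 4 ≤ q → s ≤ q ∸ 4 → (q ∸ s) ℕ.+ 1 ≡ 5 ℕ.+ (q ∸ s ∸ 4)
q∸s+1≡5+[q∸s∸4] {q} {s} 4≤q s≤q∸4 = trans (ℕ.+-comm (q ∸ s) 1) (cong suc (sym (ℕ.m+[n∸m]≡n (4≤q∸s 4≤q s≤q∸4))))

degree-budget : ∀ m q s → 1 ≤ m → 4 ≤ q → s ≤ q ∸ 4 →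
  ((m ∸ 1) ℕ.* (q ∸ 1) ℕ.+ s) ℕ.+ (2 ℕ.+ (q ∸ s ∸ 4)) < m ℕ.* (q ∸ 1)
degree-budget (suc m) q s _ 4≤q s≤q∸4 =
  subst (λ Q → (m ℕ.* (Q ∸ 1) ℕ.+ s) ℕ.+ (2 ℕ.+ k) < suc m ℕ.* (Q ∸ 1)) (sym q≡4+s+k)
    (ℕ.≤-reflexive (identity m s k))
  where
  k = q ∸ s ∸ 4
  q≡4+s+k : q ≡ 4 ℕ.+ (s ℕ.+ k)
  q≡4+s+k = begin
    q                    ≡⟨ ℕ.m+[n∸m]≡n (ℕ.≤-trans s≤q∸4 (ℕ.m∸n≤m q 4)) ⟨
    s ℕ.+ (q ∸ s)        ≡⟨ cong (s ℕ.+_) (ℕ.m+[n∸m]≡n (4≤q∸s 4≤q s≤q∸4)) ⟨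
    s ℕ.+ (4 ℕ.+ k)      ≡⟨ shift s k ⟩
    4 ℕ.+ (s ℕ.+ k)      ∎
    where
    shift : ∀ s k → s ℕ.+ (4 ℕ.+ k) ≡ 4 ℕ.+ (s ℕ.+ k)
    shift = solve-∀
    open ≡-Reasoning
  identity : ∀ m s k → suc ((m ℕ.* (3 ℕ.+ (s ℕ.+ k)) ℕ.+ s) ℕ.+ (2 ℕ.+ k)) ≡ suc m ℕ.* (3 ℕ.+ (s ℕ.+ k))
  identity = solve-∀

module _ (F : FiniteField) where
  open FiniteField F using (Carrier; isCommutativeRing; 0≢1; inverse; _≟_; size; enum)

  commutativeRing : CommutativeRing 0ℓ 0ℓ
  commutativeRing = record { isCommutativeRing = isCommutativeRing }

  open CommutativeRing commutativeRing hiding (Carrier; isCommutativeRing; refl; sym; trans; zero)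
  open import Algebra.Properties.Ring ring using (x∙y⁻¹≈ε⇒x≈y; +-identityʳ-unique)
  open import Algebra.Properties.CommutativeMonoid.Sum +-commutativeMonoid
    using (sum; sum-cong-≗; ∑-distrib-+; sum-remove; sum-replicate-zero; sum-permute)
  open import Algebra.Properties.Semiring.Sum semiring using (*-distribˡ-sum)
  open IntegerCoefficients commutativeRing
  open ≡-Reasoning

  x*y≢0 : ∀ {x y} → x ≢ 0# → y ≢ 0# → x * y ≢ 0#
  x*y≢0 {x} {y} x≢0 y≢0 xy≡0 = y≢0 (begin
    y                ≡⟨ *-identityˡ y ⟨
    1# * y           ≡⟨ cong (_* y) (trans (*-comm x⁻¹ x) (proj₂ (inverse x x≢0))) ⟨
    (x⁻¹ * x) * y    ≡⟨ *-assoc x⁻¹ x y ⟩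
    x⁻¹ * (x * y)    ≡⟨ cong (x⁻¹ *_) xy≡0 ⟩
    x⁻¹ * 0#         ≡⟨ zeroʳ x⁻¹ ⟩
    0#               ∎)
    where
    x⁻¹ = proj₁ (inverse x x≢0)

  x*y≡0⇒y≡0 : ∀ {x y} → x ≢ 0# → x * y ≡ 0# → y ≡ 0#
  x*y≡0⇒y≡0 {x} {y} x≢0 xy≡0 with y ≟ 0#
  ... | yes y≡0 = y≡0
  ... | no y≢0 = ⊥-elim (x*y≢0 x≢0 y≢0 xy≡0)

  x-y≡0⇒x≡y : ∀ {x y} → x - y ≡ 0# → x ≡ y
  x-y≡0⇒x≡y = x∙y⁻¹≈ε⇒x≈y _ _

  x≢y⇒x-y≢0 : ∀ {x y} → x ≢ y → x - y ≢ 0#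
  x≢y⇒x-y≢0 x≢y = x≢y ∘ x-y≡0⇒x≡y

  to : Fin size → Carrier
  to = Inverse.to enum

  to-injective : ∀ {i j} → to i ≡ to j → i ≡ j
  to-injective {i} {j} eq = trans (sym (Inverse.strictlyInverseʳ enum i))
    (trans (cong (Inverse.from enum) eq) (Inverse.strictlyInverseʳ enum j))

  ∑ : (Carrier → Carrier) → Carrier
  ∑ h = sum (h ∘ to)

  ∑-cong : ∀ {h k} → (∀ x → h x ≡ k x) → ∑ h ≡ ∑ k
  ∑-cong h≗k = sum-cong-≗ (h≗k ∘ to)

  ∑-+ : ∀ h k → ∑ (λ x → h x + k x) ≡ ∑ h + ∑ k
  ∑-+ h k = ∑-distrib-+ (h ∘ to) (k ∘ to)

  ∑-*ˡ : ∀ c h → ∑ (λ x → c * h x) ≡ c * ∑ h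
  ∑-*ˡ c h = sym (*-distribˡ-sum c (h ∘ to))

  ∑-0 : ∑ (λ _ → 0#) ≡ 0#
  ∑-0 = sum-replicate-zero size

  sum-single : ∀ {n} (t : Vector Carrier n) i → (∀ j → j ≢ i → t j ≡ 0#) → sum t ≡ t i
  sum-single {suc n} t i t≡0 = begin
    sum t                            ≡⟨ sum-remove {i = i} t ⟩
    t i + sum (Vector.removeAt t i)  ≡⟨ cong (t i +_) (sum-cong-≗ (λ j → t≡0 _ (Fin.punchInᵢ≢i i j))) ⟩
    t i + sum {n} (λ _ → 0#)         ≡⟨ cong (t i +_) (sum-replicate-zero n) ⟩
    t i + 0#                         ≡⟨ +-identityʳ (t i) ⟩
    t i                              ∎

  ∑-single : ∀ h a → (∀ x → x ≢ a → h x ≡ 0#) → ∑ h ≡ h a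
  ∑-single h a h≡0 = trans
    (sum-single (h ∘ to) (Inverse.from enum a) (λ j j≢ → h≡0 (to j) (j≢ ∘ to≡⇒≡from)))
    (cong h (Inverse.strictlyInverseˡ enum a))
    where
    to≡⇒≡from : ∀ {j} → to j ≡ a → j ≡ Inverse.from enum a
    to≡⇒≡from {j} eq = trans (sym (Inverse.strictlyInverseʳ enum j)) (cong (Inverse.from enum) eq)

  ∑-reindex : ∀ h (π : Carrier ↔ Carrier) → ∑ h ≡ ∑ (h ∘ Inverse.to π)
  ∑-reindex h π = trans (sum-permute (h ∘ to) σ)
    (sum-cong-≗ {size} (λ i → cong h (Inverse.strictlyInverseˡ enum (Inverse.to π (to i)))))
    where
    σ : Permutation size size
    σ = ↔-sym enum ↔-∘ (π ↔-∘ enum)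

  ∑-1 : ∑ (λ _ → 1#) ≡ 0#
  ∑-1 = +-identityʳ-unique (∑ (λ x → x)) _ (sym (begin
    ∑ (λ x → x)                ≡⟨ ∑-reindex (λ x → x) translate ⟩
    ∑ (λ x → x + 1#)           ≡⟨ ∑-+ (λ x → x) (λ _ → 1#) ⟩
    ∑ (λ x → x) + ∑ (λ _ → 1#) ∎))
    where
    translate : Carrier ↔ Carrier
    translate = mk↔ₛ′ (_+ 1#) (_- 1#)
      (λ x → solve 2 (λ x o → x :- o :+ o := x) refl x 1#)
      (λ x → solve 2 (λ x o → x :+ o :- o := x) refl x 1#)

  pow-* : ∀ a t k → pow F (a * t) k ≡ pow F a k * pow F t k
  pow-* a t zero = sym (*-identityˡ 1#)
  pow-* a t (suc k) = trans (cong ((a * t) *_) (pow-* a t k))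
    (solve 4 (λ a t x y → (a :* t) :* (x :* y) := (a :* x) :* (t :* y)) refl a t (pow F a k) (pow F t k))

  pow≢1⇒∑-pow≡0 : ∀ k a → a ≢ 0# → pow F a k ≢ 1# → ∑ (λ t → pow F t k) ≡ 0#
  pow≢1⇒∑-pow≡0 k a a≢0 aᵏ≢1 = x*y≡0⇒y≡0 (x≢y⇒x-y≢0 aᵏ≢1) (begin
    (pow F a k - 1#) * S   ≡⟨ solve 3 (λ b s o → (b :- o) :* s := b :* s :- o :* s) refl (pow F a k) S 1# ⟩
    pow F a k * S - 1# * S ≡⟨ cong₂ _-_ (sym S≡aᵏS) (*-identityˡ S) ⟩
    S - S                  ≡⟨ -‿inverseʳ S ⟩
    0#                     ∎)
    where
    S = ∑ (λ t → pow F t k)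
    a⁻¹ = proj₁ (inverse a a≢0)
    aa⁻¹≡1 : a * a⁻¹ ≡ 1#
    aa⁻¹≡1 = proj₂ (inverse a a≢0)
    scale : Carrier ↔ Carrier
    scale = mk↔ₛ′ (a *_) (a⁻¹ *_)
      (λ x → trans (sym (*-assoc a a⁻¹ x)) (trans (cong (_* x) aa⁻¹≡1) (*-identityˡ x)))
      (λ x → trans (sym (*-assoc a⁻¹ a x)) (trans (cong (_* x) (trans (*-comm a⁻¹ a) aa⁻¹≡1)) (*-identityˡ x)))
    S≡aᵏS : S ≡ pow F a k * S
    S≡aᵏS = trans (∑-reindex (λ t → pow F t k) scale)
      (trans (∑-cong (λ t → pow-* a t k)) (∑-*ˡ (pow F a k) (λ t → pow F t k)))

  horner : ∀ {n} → Vec Carrier n → Carrier → Carrier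
  horner [] x = 0#
  horner (c ∷ cs) x = c + x * horner cs x

  leading : ∀ {n} → Vec Carrier (suc n) → Carrier
  leading (c ∷ []) = c
  leading (c ∷ d ∷ ds) = leading (d ∷ ds)

  quotient : ∀ {n} → Carrier → Vec Carrier (suc n) → Vec Carrier n
  quotient a (c ∷ []) = []
  quotient a (c ∷ d ∷ ds) = horner (d ∷ ds) a ∷ quotient a (d ∷ ds)

  horner-quotient : ∀ {n} a (p : Vec Carrier (suc n)) x →
    horner p x ≡ horner p a + (x - a) * horner (quotient a p) x
  horner-quotient a (c ∷ []) x =
    solve 3 (λ c x a → c :+ x :* :0 := (c :+ a :* :0) :+ (x :- a) :* :0) refl c x a
  horner-quotient a (c ∷ d ∷ ds) x = begin
    c + x * horner (d ∷ ds) x                ≡⟨ cong (λ y → c + x * y) (horner-quotient a (d ∷ ds) x) ⟩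
    c + x * (P + (x - a) * Q)
      ≡⟨ solve 5 (λ c x a P Q → c :+ x :* (P :+ (x :- a) :* Q) := (c :+ a :* P) :+ (x :- a) :* (P :+ x :* Q)) refl c x a P Q ⟩
    (c + a * P) + (x - a) * (P + x * Q)      ∎
    where
    P = horner (d ∷ ds) a
    Q = horner (quotient a (d ∷ ds)) x

  leading-quotient : ∀ {n} a (p : Vec Carrier (suc (suc n))) → leading (quotient a p) ≡ leading p
  leading-quotient a (c ∷ d ∷ []) = trans (cong (d +_) (zeroʳ a)) (+-identityʳ d)
  leading-quotient a (c ∷ d ∷ e ∷ es) = leading-quotient a (d ∷ e ∷ es)

  many-roots⇒leading≡0 : ∀ {n} (p : Vec Carrier (suc n)) (rs : List Carrier) → suc n ≤ length rs →
    Unique rs → All (λ r → horner p r ≡ 0#) rs → leading p ≡ 0#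
  many-roots⇒leading≡0 {zero} (c ∷ []) (r ∷ rs) _ _ (pr≡0 ∷ _) = trans (sym (trans (cong (c +_) (zeroʳ r)) (+-identityʳ c))) pr≡0
  many-roots⇒leading≡0 {suc n} p (a ∷ rs) (s≤s n<rs) (a∉rs ∷ rs!) (pa≡0 ∷ prs≡0) =
    trans (sym (leading-quotient a p)) (many-roots⇒leading≡0 (quotient a p) rs n<rs rs! (All.zipWith (uncurry quotient-root) (a∉rs , prs≡0)))
    where
    quotient-root : ∀ {r} → a ≢ r → horner p r ≡ 0# → horner (quotient a p) r ≡ 0#
    quotient-root {r} a≢r pr≡0 = x*y≡0⇒y≡0 (x≢y⇒x-y≢0 (a≢r ∘ sym)) (begin
      (r - a) * horner (quotient a p) r          ≡⟨ +-identityˡ _ ⟨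
      0# + (r - a) * horner (quotient a p) r     ≡⟨ cong (_+ (r - a) * horner (quotient a p) r) pa≡0 ⟨
      horner p a + (r - a) * horner (quotient a p) r ≡⟨ horner-quotient a p r ⟨
      horner p r                                 ≡⟨ pr≡0 ⟩
      0#                                         ∎)

  Xpow : ∀ k → Vec Carrier (suc k)
  Xpow zero = 1# ∷ []
  Xpow (suc k) = 0# ∷ Xpow k

  horner-Xpow : ∀ k x → horner (Xpow k) x ≡ pow F x k
  horner-Xpow zero x = trans (cong (1# +_) (zeroʳ x)) (+-identityʳ 1#)
  horner-Xpow (suc k) x = trans (+-identityˡ _) (cong (x *_) (horner-Xpow k x))

  leading-∷ : ∀ {n} c (p : Vec Carrier (suc n)) → leading (c ∷ p) ≡ leading p
  leading-∷ c (d ∷ ds) = refl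

  leading-Xpow : ∀ k → leading (Xpow k) ≡ 1#
  leading-Xpow zero = refl
  leading-Xpow (suc k) = trans (leading-∷ 0# (Xpow k)) (leading-Xpow k)

  k<n∸1⇒2+k≤n : ∀ {k} n → k < n ∸ 1 → suc (suc k) ≤ n
  k<n∸1⇒2+k≤n (suc n) k<n = s≤s k<n

  ∃-pow≢1 : ∀ k → 1 ≤ k → k < size ∸ 1 → ∃ λ a → a ≢ 0# × pow F a k ≢ 1#
  ∃-pow≢1 (suc j) _ k<q-1
    with Fin.any? (λ i → ¬? (to i ≟ 0#) ×-dec ¬? (pow F (to i) (suc j) ≟ 1#))
  ... | yes (i , to-i≢0 , to-iᵏ≢1) = to i , to-i≢0 , to-iᵏ≢1
  ... | no none = ⊥-elim (0≢1 (sym (begin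
    1#                   ≡⟨ leading-Xpow j ⟨
    leading (Xpow j)     ≡⟨ leading-∷ (- 1#) (Xpow j) ⟨
    leading P            ≡⟨ many-roots⇒leading≡0 P (tabulate to) deg<q (Unique.tabulate⁺ to-injective)
                             (All.tabulate⁺ (λ i → root (to i) (unit i))) ⟩
    0#                   ∎)))
    where
    -- the coefficients of X^(j+2) - X, whose roots are 0 and the elements x with x^(j+1) = 1
    P : Vec Carrier (suc (suc (suc j)))
    P = 0# ∷ - 1# ∷ Xpow j
    deg<q : suc (suc (suc j)) ≤ length (tabulate to)
    deg<q = ℕ.≤-trans (k<n∸1⇒2+k≤n size k<q-1) (ℕ.≤-reflexive (sym (List.length-tabulate to)))
    unit : ∀ i → to i ≢ 0# → pow F (to i) (suc j) ≡ 1#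
    unit i to-i≢0 with pow F (to i) (suc j) ≟ 1#
    ... | yes to-iᵏ≡1 = to-iᵏ≡1
    ... | no to-iᵏ≢1 = ⊥-elim (none (i , to-i≢0 , to-iᵏ≢1))
    root : ∀ x → (x ≢ 0# → pow F x (suc j) ≡ 1#) → horner P x ≡ 0#
    root x xᵏ≡1 = trans (cong (λ y → 0# + x * (- 1# + x * y)) (horner-Xpow j x))
      (trans (solve 3 (λ x y o → :0 :+ x :* (:- o :+ y) := x :* (y :- o)) refl x (pow F x (suc j)) 1#)
        (vanish (x ≟ 0#)))
      where
      vanish : Dec (x ≡ 0#) → x * (pow F x (suc j) - 1#) ≡ 0#
      vanish (yes x≡0) = trans (cong (_* (pow F x (suc j) - 1#)) x≡0) (zeroˡ _)
      vanish (no x≢0) = trans (cong (λ y → x * (y - 1#)) (xᵏ≡1 x≢0)) (trans (cong (x *_) (-‿inverseʳ 1#)) (zeroʳ x))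

  ∑-pow≡0 : ∀ k → k < size ∸ 1 → ∑ (λ t → pow F t k) ≡ 0#
  ∑-pow≡0 zero _ = ∑-1
  ∑-pow≡0 (suc j) k<q-1 with ∃-pow≢1 (suc j) (s≤s z≤n) k<q-1
  ... | a , a≢0 , aᵏ≢1 = pow≢1⇒∑-pow≡0 (suc j) a a≢0 aᵏ≢1

  ∑ᵐ : ∀ m → (Point F m → Carrier) → Carrier
  ∑ᵐ zero h = h Vector.[]
  ∑ᵐ (suc m) h = ∑ λ a → ∑ᵐ m (λ x → h (a Vector.∷ x))

  ∑ᵐ-cong : ∀ m {h k : Point F m → Carrier} → (∀ x → h x ≡ k x) → ∑ᵐ m h ≡ ∑ᵐ m k
  ∑ᵐ-cong zero h≗k = h≗k _
  ∑ᵐ-cong (suc m) h≗k = ∑-cong (λ a → ∑ᵐ-cong m (λ x → h≗k (a Vector.∷ x)))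

  ∑ᵐ-+ : ∀ m (h k : Point F m → Carrier) → ∑ᵐ m (λ x → h x + k x) ≡ ∑ᵐ m h + ∑ᵐ m k
  ∑ᵐ-+ zero h k = refl
  ∑ᵐ-+ (suc m) h k = trans (∑-cong (λ a → ∑ᵐ-+ m (λ x → h (a Vector.∷ x)) (λ x → k (a Vector.∷ x))))
    (∑-+ (λ a → ∑ᵐ m (λ x → h (a Vector.∷ x))) (λ a → ∑ᵐ m (λ x → k (a Vector.∷ x))))

  ∑ᵐ-*ˡ : ∀ m c (h : Point F m → Carrier) → ∑ᵐ m (λ x → c * h x) ≡ c * ∑ᵐ m h
  ∑ᵐ-*ˡ zero c h = refl
  ∑ᵐ-*ˡ (suc m) c h = trans (∑-cong (λ a → ∑ᵐ-*ˡ m c (λ x → h (a Vector.∷ x))))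
    (∑-*ˡ c (λ a → ∑ᵐ m (λ x → h (a Vector.∷ x))))

  ∑ᵐ-0 : ∀ m → ∑ᵐ m (λ _ → 0#) ≡ 0#
  ∑ᵐ-0 zero = refl
  ∑ᵐ-0 (suc m) = trans (∑-cong (λ _ → ∑ᵐ-0 m)) ∑-0

  -- Points are functions, so evaluation at a point is only known to respect pointwise equality.
  Respects≗ : ∀ {m} → (Point F m → Carrier) → Set
  Respects≗ h = ∀ {x y} → x ≗ y → h x ≡ h y

  ∑ᵐ-single : ∀ m (h : Point F m → Carrier) a → Respects≗ h → (∀ x → ¬ x ≗ a → h x ≡ 0#) → ∑ᵐ m h ≡ h a
  ∑ᵐ-single zero h a resp _ = resp (λ ())
  ∑ᵐ-single (suc m) h a resp h≡0 = begin
    ∑ (λ b → ∑ᵐ m (λ x → h (b Vector.∷ x)))   ≡⟨ ∑-single _ (a zero) (λ b b≢a₀ → trans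
                                                    (∑ᵐ-cong m (λ x → h≡0 (b Vector.∷ x) (λ b∷x≗a → b≢a₀ (b∷x≗a zero)))) (∑ᵐ-0 m)) ⟩
    ∑ᵐ m (λ x → h (a zero Vector.∷ x))        ≡⟨ ∑ᵐ-single m (λ x → h (a zero Vector.∷ x)) (Vector.tail a)
                                                    (λ x≗y → resp (λ { zero → refl ; (suc i) → x≗y i }))
                                                    (λ x x≉ → h≡0 (a zero Vector.∷ x) (λ a₀∷x≗a → x≉ (a₀∷x≗a ∘ suc))) ⟩
    h (a zero Vector.∷ Vector.tail a)          ≡⟨ resp (λ { zero → refl ; (suc i) → refl }) ⟩
    h a                                        ∎

  monomial : ∀ {m} → (Fin m → ℕ) → Point F m → Carrier
  monomial {m} e x = prodFin F m (λ i → pow F (x i) (e i))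

  ∑ᵐ-monomial≡0 : ∀ m e → sumFin F m e < m ℕ.* (size ∸ 1) → ∑ᵐ m (monomial e) ≡ 0#
  ∑ᵐ-monomial≡0 (suc m) e deg< = begin
    ∑ (λ a → ∑ᵐ m (λ x → pow F a (e zero) * monomial e′ x))  ≡⟨ ∑-cong (λ a → ∑ᵐ-*ˡ m (pow F a (e zero)) (monomial e′)) ⟩
    ∑ (λ a → pow F a (e zero) * S′)                          ≡⟨ ∑-cong (λ a → *-comm (pow F a (e zero)) S′) ⟩
    ∑ (λ a → S′ * pow F a (e zero))                          ≡⟨ ∑-*ˡ S′ (λ a → pow F a (e zero)) ⟩
    S′ * ∑ (λ a → pow F a (e zero))                          ≡⟨ one-factor-vanishes (ℕ.<-≤-connex (e zero) (size ∸ 1)) ⟩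
    0#                                                      ∎
    where
    e′ = Vector.tail e
    S′ = ∑ᵐ m (monomial e′)
    one-factor-vanishes : e zero < size ∸ 1 ⊎ size ∸ 1 ≤ e zero → S′ * ∑ (λ a → pow F a (e zero)) ≡ 0#
    one-factor-vanishes (inj₁ e₀<q-1) = trans (cong (S′ *_) (∑-pow≡0 (e zero) e₀<q-1)) (zeroʳ S′)
    one-factor-vanishes (inj₂ q-1≤e₀) = trans (cong (_* ∑ (λ a → pow F a (e zero))) (∑ᵐ-monomial≡0 m e′ deg′<)) (zeroˡ _)
      where
      deg′< : sumFin F m e′ < m ℕ.* (size ∸ 1)
      deg′< = ℕ.+-cancelˡ-< (size ∸ 1) _ _ (ℕ.≤-<-trans (ℕ.+-monoˡ-≤ (sumFin F m e′) q-1≤e₀) deg<)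

  monomial-raise : ∀ {m} i (e : Fin m → ℕ) x → monomial (Vector.updateAt e i suc) x ≡ x i * monomial e x
  monomial-raise {suc m} zero e x = *-assoc (x zero) _ _
  monomial-raise {suc m} (suc i) e x = trans (cong (pow F (x zero) (e zero) *_) (monomial-raise i (Vector.tail e) (Vector.tail x)))
    (solve 3 (λ a b c → a :* (b :* c) := b :* (a :* c)) refl _ _ _)

  degree-raise : ∀ {m} i (e : Fin m → ℕ) → sumFin F m (Vector.updateAt e i suc) ≡ suc (sumFin F m e)
  degree-raise {suc m} zero e = refl
  degree-raise {suc m} (suc i) e = trans (cong (e zero ℕ.+_) (degree-raise i (Vector.tail e))) (ℕ.+-suc _ _)

  -- Affine forms x ↦ α xᵢ + β xⱼ + γ in at most two coordinates: enough to cut out a line through two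
  -- points or a hyperplane through one, and their products are easily integrated against monomials.
  record AffineForm (m : ℕ) : Set where
    constructor affine
    field
      i j : Fin m
      α β γ : Carrier

  ⟪_⟫ : ∀ {m} → AffineForm m → Point F m → Carrier
  ⟪ affine i j α β γ ⟫ x = α * x i + β * x j + γ

  ∏ : ∀ {m} → List (AffineForm m) → Point F m → Carrier
  ∏ [] x = 1#
  ∏ (ℓ ∷ ℓs) x = ⟪ ℓ ⟫ x * ∏ ℓs x

  ∑ᵐ-monomial*∏≡0 : ∀ m (ℓs : List (AffineForm m)) e → sumFin F m e ℕ.+ length ℓs < m ℕ.* (size ∸ 1) →
    ∑ᵐ m (λ x → monomial e x * ∏ ℓs x) ≡ 0#
  ∑ᵐ-monomial*∏≡0 m [] e deg< = trans (∑ᵐ-cong m (λ x → *-identityʳ _))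
    (∑ᵐ-monomial≡0 m e (subst (_< m ℕ.* (size ∸ 1)) (ℕ.+-identityʳ _) deg<))
  ∑ᵐ-monomial*∏≡0 m (affine i j α β γ ∷ ℓs) e deg< = begin
    ∑ᵐ m (λ x → M e x * ((α * x i + β * x j + γ) * ∏ ℓs x))
      ≡⟨ ∑ᵐ-cong m expand ⟩
    ∑ᵐ m (λ x → α * I i x + β * I j x + γ * J x)
      ≡⟨ trans (∑ᵐ-+ m _ _) (cong (_+ ∑ᵐ m (λ x → γ * J x)) (∑ᵐ-+ m _ _)) ⟩
    ∑ᵐ m (λ x → α * I i x) + ∑ᵐ m (λ x → β * I j x) + ∑ᵐ m (λ x → γ * J x)
      ≡⟨ cong₂ _+_ (cong₂ _+_ (∑ᵐ-*ˡ m α _) (∑ᵐ-*ˡ m β _)) (∑ᵐ-*ˡ m γ _) ⟩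
    α * ∑ᵐ m (I i) + β * ∑ᵐ m (I j) + γ * ∑ᵐ m J
      ≡⟨ cong₂ _+_ (cong₂ _+_ (cong (α *_) (raised i)) (cong (β *_) (raised j))) (cong (γ *_) unraised) ⟩
    α * 0# + β * 0# + γ * 0#
      ≡⟨ solve 3 (λ a b c → a :* :0 :+ b :* :0 :+ c :* :0 := :0) refl α β γ ⟩
    0# ∎
    where
    M = monomial
    I : Fin m → Point F m → Carrier
    I k x = M (Vector.updateAt e k suc) x * ∏ ℓs x
    J : Point F m → Carrier
    J x = M e x * ∏ ℓs x
    raised : ∀ k → ∑ᵐ m (I k) ≡ 0#
    raised k = ∑ᵐ-monomial*∏≡0 m ℓs (Vector.updateAt e k suc)
      (subst (_< m ℕ.* (size ∸ 1)) (trans (ℕ.+-suc _ _) (cong (ℕ._+ length ℓs) (sym (degree-raise k e)))) deg<)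
    unraised : ∑ᵐ m J ≡ 0#
    unraised = ∑ᵐ-monomial*∏≡0 m ℓs e (ℕ.<-trans (ℕ.+-monoʳ-< _ (ℕ.n<1+n _)) deg<)
    expand : ∀ x → M e x * ((α * x i + β * x j + γ) * ∏ ℓs x) ≡ α * I i x + β * I j x + γ * J x
    expand x = begin
      M e x * ((α * x i + β * x j + γ) * ∏ ℓs x)
        ≡⟨ solve 7 (λ m xi xj g a b c → m :* ((a :* xi :+ b :* xj :+ c) :* g)
                                        := a :* ((xi :* m) :* g) :+ b :* ((xj :* m) :* g) :+ c :* (m :* g))
             refl (M e x) (x i) (x j) (∏ ℓs x) α β γ ⟩
      α * ((x i * M e x) * ∏ ℓs x) + β * ((x j * M e x) * ∏ ℓs x) + γ * J x
        ≡⟨ cong₂ (λ u v → α * (u * ∏ ℓs x) + β * (v * ∏ ℓs x) + γ * J x)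
             (sym (monomial-raise i e x)) (sym (monomial-raise j e x)) ⟩
      α * I i x + β * I j x + γ * J x ∎

  ∑ᵐ-poly*∏≡0 : ∀ m r (ℓs : List (AffineForm m)) (g : Poly F m) → DegAtMost F m r g →
    r ℕ.+ length ℓs < m ℕ.* (size ∸ 1) → ∑ᵐ m (λ x → evalPoly F m g x * ∏ ℓs x) ≡ 0#
  ∑ᵐ-poly*∏≡0 m r ℓs [] [] deg< = trans (∑ᵐ-cong m (λ x → zeroˡ _)) (∑ᵐ-0 m)
  ∑ᵐ-poly*∏≡0 m r ℓs ((c , e) ∷ g) (e≤r ∷ g≤r) deg< = begin
    ∑ᵐ m (λ x → (c * monomial e x + G x) * ∏ ℓs x)
      ≡⟨ ∑ᵐ-cong m (λ x → solve 4 (λ c M G P → (c :* M :+ G) :* P := c :* (M :* P) :+ G :* P) refl c (monomial e x) (G x) (∏ ℓs x)) ⟩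
    ∑ᵐ m (λ x → c * (monomial e x * ∏ ℓs x) + G x * ∏ ℓs x)
      ≡⟨ ∑ᵐ-+ m _ _ ⟩
    ∑ᵐ m (λ x → c * (monomial e x * ∏ ℓs x)) + ∑ᵐ m (λ x → G x * ∏ ℓs x)
      ≡⟨ cong₂ _+_ (trans (∑ᵐ-*ˡ m c _) (cong (c *_) (∑ᵐ-monomial*∏≡0 m ℓs e e+ℓs<)))
                   (∑ᵐ-poly*∏≡0 m r ℓs g g≤r deg<) ⟩
    c * 0# + 0#
      ≡⟨ trans (+-identityʳ _) (zeroʳ c) ⟩
    0# ∎
    where
    G = evalPoly F m g
    e+ℓs< = ℕ.≤-<-trans (ℕ.+-monoˡ-≤ (length ℓs) e≤r) deg<

  prodFin-cong : ∀ m {g h : Fin m → Carrier} → (∀ i → g i ≡ h i) → prodFin F m g ≡ prodFin F m h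
  prodFin-cong zero g≗h = refl
  prodFin-cong (suc m) g≗h = cong₂ _*_ (g≗h zero) (prodFin-cong m (g≗h ∘ suc))

  evalPoly-resp : ∀ m (p : Poly F m) → Respects≗ (evalPoly F m p)
  evalPoly-resp m [] x≗y = refl
  evalPoly-resp m ((c , e) ∷ p) x≗y =
    cong₂ _+_ (cong (c *_) (prodFin-cong m (λ i → cong (λ z → pow F z (e i)) (x≗y i)))) (evalPoly-resp m p x≗y)

  ⟪⟫-resp : ∀ {m} (ℓ : AffineForm m) → Respects≗ ⟪ ℓ ⟫
  ⟪⟫-resp (affine i j α β γ) x≗y = cong₂ (λ u v → α * u + β * v + γ) (x≗y i) (x≗y j)

  ∏-resp : ∀ {m} (ℓs : List (AffineForm m)) → Respects≗ (∏ ℓs)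
  ∏-resp [] x≗y = refl
  ∏-resp (ℓ ∷ ℓs) x≗y = cong₂ _*_ (⟪⟫-resp ℓ x≗y) (∏-resp ℓs x≗y)

  isolating⇒degree-bound : ∀ m r (g : Poly F m) → DegAtMost F m r g → (a : Point F m) (ℓs : List (AffineForm m)) →
    evalPoly F m g a ≢ 0# → ∏ ℓs a ≢ 0# → (∀ x → evalPoly F m g x ≢ 0# → ¬ x ≗ a → ∏ ℓs x ≡ 0#) →
    m ℕ.* (size ∸ 1) ≤ r ℕ.+ length ℓs
  isolating⇒degree-bound m r g g≤r a ℓs ga≢0 ℓsa≢0 isolates = ℕ.≮⇒≥ λ deg< → x*y≢0 ga≢0 ℓsa≢0 (begin
    G a * ∏ ℓs a                ≡⟨ ∑ᵐ-single m (λ x → G x * ∏ ℓs x) a G∏-resp vanishes ⟨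
    ∑ᵐ m (λ x → G x * ∏ ℓs x)   ≡⟨ ∑ᵐ-poly*∏≡0 m r ℓs g g≤r deg< ⟩
    0#                          ∎)
    where
    G = evalPoly F m g
    G∏-resp : Respects≗ (λ x → G x * ∏ ℓs x)
    G∏-resp x≗y = cong₂ _*_ (evalPoly-resp m g x≗y) (∏-resp ℓs x≗y)
    vanishes : ∀ x → ¬ x ≗ a → G x * ∏ ℓs x ≡ 0#
    vanishes x x≉a with G x ≟ 0#
    ... | yes gx≡0 = trans (cong (_* ∏ ℓs x) gx≡0) (zeroˡ _)
    ... | no gx≢0 = trans (cong (G x *_) (isolates x gx≢0 x≉a)) (zeroʳ _)

  ∃-coordinate-≢ : ∀ {m} {x y : Point F m} → ¬ x ≗ y → ∃ λ i → x i ≢ y i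
  ∃-coordinate-≢ {x = x} {y} x≉y = Fin.¬∀⟶∃¬ _ _ (λ i → x i ≟ y i) x≉y

  _⊖_ : ∀ {m} → Point F m → Point F m → Point F m
  (x ⊖ y) i = x i - y i

  Proportional : ∀ {m} → Point F m → Point F m → Set
  Proportional u v = ∀ i j → u i * v j ≡ u j * v i

  Proportional-sym : ∀ {m} {u v : Point F m} → Proportional u v → Proportional v u
  Proportional-sym {u = u} {v} u∥v i j = trans (*-comm (v i) (u j)) (trans (u∥v j i) (*-comm (u i) (v j)))

  Proportional-trans : ∀ {m} {u v w : Point F m} k → u k ≢ 0# → Proportional u v → Proportional u w → Proportional v w
  Proportional-trans {u = u} {v} {w} k uₖ≢0 u∥v u∥w j l = x-y≡0⇒x≡y (x*y≡0⇒y≡0 (x*y≢0 uₖ≢0 uₖ≢0) (begin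
    u k * u k * (v j * w l - v l * w j)
      ≡⟨ solve 5 (λ uk vj wl vl wj → uk :* uk :* (vj :* wl :- vl :* wj) := (uk :* vj) :* (uk :* wl) :- (uk :* vl) :* (uk :* wj))
           refl (u k) (v j) (w l) (v l) (w j) ⟩
    (u k * v j) * (u k * w l) - (u k * v l) * (u k * w j)
      ≡⟨ cong₂ (λ s t → s * t - (u k * v l) * (u k * w j)) (u∥v k j) (u∥w k l) ⟩
    (u j * v k) * (u l * w k) - (u k * v l) * (u k * w j)
      ≡⟨ cong₂ (λ s t → (u j * v k) * (u l * w k) - s * t) (u∥v k l) (u∥w k j) ⟩
    (u j * v k) * (u l * w k) - (u l * v k) * (u j * w k)
      ≡⟨ solve 4 (λ uj vk ul wk → (uj :* vk) :* (ul :* wk) :- (ul :* vk) :* (uj :* wk) := :0) refl (u j) (v k) (u l) (w k) ⟩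
    0# ∎))

  Collinear : ∀ {m} → Point F m → Point F m → Point F m → Set
  Collinear p x y = Proportional (x ⊖ p) (y ⊖ p)

  collinear? : ∀ {m} (p x y : Point F m) → Dec (Collinear p x y)
  collinear? p x y = Fin.all? λ i → Fin.all? λ j → ((x ⊖ p) i * (y ⊖ p) j) ≟ ((x ⊖ p) j * (y ⊖ p) i)

  Collinear-swapʳ : ∀ {m} {p x y : Point F m} → Collinear p x y → Collinear p y x
  Collinear-swapʳ = Proportional-sym

  Collinear-swapˡ : ∀ {m} {p x y : Point F m} → Collinear p x y → Collinear x p y
  Collinear-swapˡ {p = p} {x} {y} pxy i j = x-y≡0⇒x≡y (begin
    (p i - x i) * (y j - x j) - (p j - x j) * (y i - x i)
      ≡⟨ solve 6 (λ pi pj xi xj yi yj → (pi :- xi) :* (yj :- xj) :- (pj :- xj) :* (yi :- xi)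
                                        := :- ((xi :- pi) :* (yj :- pj) :- (xj :- pj) :* (yi :- pi)))
           refl (p i) (p j) (x i) (x j) (y i) (y j) ⟩
    - ((x i - p i) * (y j - p j) - (x j - p j) * (y i - p i))
      ≡⟨ cong (λ t → - (t - (x j - p j) * (y i - p i))) (pxy i j) ⟩
    - ((x j - p j) * (y i - p i) - (x j - p j) * (y i - p i))
      ≡⟨ solve 1 (λ t → :- (t :- t) := :0) refl ((x j - p j) * (y i - p i)) ⟩
    0# ∎)

  Collinear-trans : ∀ {m} {p x y z : Point F m} → ¬ x ≗ p → Collinear p x y → Collinear p x z → Collinear p y z
  Collinear-trans x≉p with ∃-coordinate-≢ x≉p
  ... | k , xₖ≢pₖ = Proportional-trans k (x≢y⇒x-y≢0 xₖ≢pₖ)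

  -- In the (i, j)-coordinates this is the determinant of v - u and x - u.
  lineForm : ∀ {m} (u v : Point F m) (i j : Fin m) → AffineForm m
  lineForm u v i j = affine j i (v i - u i) (- (v j - u j)) ((v j - u j) * u i - (v i - u i) * u j)

  ⟪lineForm⟫ : ∀ {m} (u v : Point F m) i j x →
    ⟪ lineForm u v i j ⟫ x ≡ (v i - u i) * (x j - u j) - (v j - u j) * (x i - u i)
  ⟪lineForm⟫ u v i j x =
    solve 6 (λ dᵢ dⱼ uᵢ uⱼ xᵢ xⱼ → dᵢ :* xⱼ :+ :- dⱼ :* xᵢ :+ (dⱼ :* uᵢ :- dᵢ :* uⱼ) := dᵢ :* (xⱼ :- uⱼ) :- dⱼ :* (xᵢ :- uᵢ))
      refl (v i - u i) (v j - u j) (u i) (u j) (x i) (x j)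

  ∃-nonproportional : ∀ {m} {u v : Point F m} → ¬ Proportional u v → ∃₂ λ i j → u i * v j ≢ u j * v i
  ∃-nonproportional {u = u} {v} ¬u∥v with Fin.¬∀⟶∃¬ _ _ (λ i → Fin.all? λ j → (u i * v j) ≟ (u j * v i)) ¬u∥v
  ... | i , ¬u∥vᵢ with Fin.¬∀⟶∃¬ _ _ (λ j → (u i * v j) ≟ (u j * v i)) ¬u∥vᵢ
  ... | j , ¬u∥vᵢⱼ = i , j , ¬u∥vᵢⱼ

  separating-line : ∀ {m} {p u v : Point F m} → ¬ Collinear p u v →
    ∃ λ ℓ → ⟪ ℓ ⟫ u ≡ 0# × ⟪ ℓ ⟫ v ≡ 0# × ⟪ ℓ ⟫ p ≢ 0#
  separating-line {p = p} {u} {v} ¬puv = lineForm u v i j , ℓu≡0 , ℓv≡0 , ℓp≢0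
    where
    ij = ∃-nonproportional {u = v ⊖ u} {p ⊖ u} (¬puv ∘ Collinear-swapˡ ∘ Collinear-swapʳ)
    i = proj₁ ij
    j = proj₁ (proj₂ ij)
    ℓu≡0 : ⟪ lineForm u v i j ⟫ u ≡ 0#
    ℓu≡0 = trans (⟪lineForm⟫ u v i j u)
      (solve 4 (λ dᵢ dⱼ uᵢ uⱼ → dᵢ :* (uⱼ :- uⱼ) :- dⱼ :* (uᵢ :- uᵢ) := :0) refl (v i - u i) (v j - u j) (u i) (u j))
    ℓv≡0 : ⟪ lineForm u v i j ⟫ v ≡ 0#
    ℓv≡0 = trans (⟪lineForm⟫ u v i j v) (solve 2 (λ dᵢ dⱼ → dᵢ :* dⱼ :- dⱼ :* dᵢ := :0) refl (v i - u i) (v j - u j))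
    ℓp≢0 : ⟪ lineForm u v i j ⟫ p ≢ 0#
    ℓp≢0 = x≢y⇒x-y≢0 (proj₂ (proj₂ ij)) ∘ trans (sym (⟪lineForm⟫ u v i j p))

  separating-hyperplane : ∀ {m} {p u : Point F m} → ¬ u ≗ p → ∃ λ ℓ → ⟪ ℓ ⟫ u ≡ 0# × ⟪ ℓ ⟫ p ≢ 0#
  separating-hyperplane {p = p} {u} u≉p with ∃-coordinate-≢ u≉p
  ... | i , uᵢ≢pᵢ = affine i i 1# 0# (- u i)
    , trans (⟪hyperplane⟫ u) (-‿inverseʳ (u i))
    , x≢y⇒x-y≢0 (uᵢ≢pᵢ ∘ sym) ∘ trans (sym (⟪hyperplane⟫ p))
    where
    ⟪hyperplane⟫ : ∀ x → ⟪ affine i i 1# 0# (- u i) ⟫ x ≡ x i - u i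
    ⟪hyperplane⟫ x = trans (cong₂ (λ s t → s + t + - u i) (*-identityˡ (x i)) (zeroˡ (x i)))
      (cong (_- u i) (+-identityʳ (x i)))

  ∏-++ : ∀ {m} (ℓs ℓs′ : List (AffineForm m)) x → ∏ (ℓs List.++ ℓs′) x ≡ ∏ ℓs x * ∏ ℓs′ x
  ∏-++ [] ℓs′ x = sym (*-identityˡ _)
  ∏-++ (ℓ ∷ ℓs) ℓs′ x = trans (cong (⟪ ℓ ⟫ x *_) (∏-++ ℓs ℓs′ x)) (sym (*-assoc _ _ _))

  ∏-vanishes-∷ : ∀ {m} (ℓ : AffineForm m) {ℓs x} → ∏ ℓs x ≡ 0# → ∏ (ℓ ∷ ℓs) x ≡ 0#
  ∏-vanishes-∷ ℓ {x = x} ℓsx≡0 = trans (cong (⟪ ℓ ⟫ x *_) ℓsx≡0) (zeroʳ _)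

  ∏-vanishes : ∀ {m} {ℓ : AffineForm m} {ℓs x} → ℓ ∈ ℓs → ⟪ ℓ ⟫ x ≡ 0# → ∏ ℓs x ≡ 0#
  ∏-vanishes {ℓs = _ ∷ ℓs} {x} (here refl) ℓx≡0 = trans (cong (_* ∏ ℓs x) ℓx≡0) (zeroˡ _)
  ∏-vanishes {ℓs = ℓ′ ∷ ℓs} {x} (there ℓ∈ℓs) ℓx≡0 = ∏-vanishes-∷ ℓ′ {ℓs} {x} (∏-vanishes ℓ∈ℓs ℓx≡0)

  ∏≢0 : ∀ {m} {ℓs : List (AffineForm m)} {x} → All (λ ℓ → ⟪ ℓ ⟫ x ≢ 0#) ℓs → ∏ ℓs x ≢ 0#
  ∏≢0 [] = 0≢1 ∘ sym
  ∏≢0 (ℓx≢0 ∷ ℓsx≢0) = x*y≢0 ℓx≢0 (∏≢0 ℓsx≢0)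

  Isolates : ∀ {m} → List (AffineForm m) → Point F m → List (Point F m) → Set
  Isolates ℓs p ys = ∏ ℓs p ≢ 0# × All (λ y → y ≡ p ⊎ ∏ ℓs y ≡ 0#) ys

  Isolates-++ : ∀ {m} {ℓs ℓs′ : List (AffineForm m)} {p ys ys′} →
    Isolates ℓs p ys → Isolates ℓs′ p ys′ → Isolates (ℓs List.++ ℓs′) p (ys List.++ ys′)
  Isolates-++ {ℓs = ℓs} {ℓs′} {p} (ℓsp≢0 , ys-ok) (ℓs′p≢0 , ys′-ok) =
      x*y≢0 ℓsp≢0 ℓs′p≢0 ∘ trans (sym (∏-++ ℓs ℓs′ p))
    , All.++⁺ (All.map (Data.Sum.map₂ vanishesˡ) ys-ok) (All.map (Data.Sum.map₂ vanishesʳ) ys′-ok)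
    where
    vanishesˡ : ∀ {y} → ∏ ℓs y ≡ 0# → ∏ (ℓs List.++ ℓs′) y ≡ 0#
    vanishesˡ {y} ℓsy≡0 = trans (∏-++ ℓs ℓs′ y) (trans (cong (_* ∏ ℓs′ y) ℓsy≡0) (zeroˡ _))
    vanishesʳ : ∀ {y} → ∏ ℓs′ y ≡ 0# → ∏ (ℓs List.++ ℓs′) y ≡ 0#
    vanishesʳ {y} ℓs′y≡0 = trans (∏-++ ℓs ℓs′ y) (trans (cong (∏ ℓs y *_) ℓs′y≡0) (zeroʳ _))

  hyperplanes-isolating : ∀ {m} (p : Point F m) ys → All (λ y → ¬ y ≗ p) ys →
    ∃ λ ℓs → length ℓs ≡ length ys × Isolates ℓs p ys
  hyperplanes-isolating p [] [] = [] , refl , 0≢1 ∘ sym , []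
  hyperplanes-isolating p (y ∷ ys) (y≉p ∷ ys≉p) with separating-hyperplane y≉p | hyperplanes-isolating p ys ys≉p
  ... | ℓ , ℓy≡0 , ℓp≢0 | ℓs , len , ℓsp≢0 , ys-ok =
      ℓ ∷ ℓs , cong suc len , x*y≢0 ℓp≢0 ℓsp≢0
    , inj₂ (∏-vanishes {ℓs = ℓ ∷ ℓs} {y} (here refl) ℓy≡0)
      ∷ All.map (λ {z} → Data.Sum.map₂ (∏-vanishes-∷ ℓ {ℓs} {z})) ys-ok

  two-forms-isolating : ∀ {m} {ℓ₁ ℓ₂ : AffineForm m} {p ys} → ⟪ ℓ₁ ⟫ p ≢ 0# → ⟪ ℓ₂ ⟫ p ≢ 0# →
    All (λ y → y ≡ p ⊎ ⟪ ℓ₁ ⟫ y ≡ 0# ⊎ ⟪ ℓ₂ ⟫ y ≡ 0#) ys → Isolates (ℓ₁ ∷ ℓ₂ ∷ []) p ys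
  two-forms-isolating {ℓ₁ = ℓ₁} {ℓ₂} {p} ℓ₁p≢0 ℓ₂p≢0 ys-ok =
    ∏≢0 {x = p} (ℓ₁p≢0 ∷ ℓ₂p≢0 ∷ []) , All.map (Data.Sum.map₂ on-a-line) ys-ok
    where
    on-a-line : ∀ {y} → ⟪ ℓ₁ ⟫ y ≡ 0# ⊎ ⟪ ℓ₂ ⟫ y ≡ 0# → ∏ (ℓ₁ ∷ ℓ₂ ∷ []) y ≡ 0#
    on-a-line {y} (inj₁ ℓ₁y≡0) = ∏-vanishes {ℓs = ℓ₁ ∷ ℓ₂ ∷ []} {y} (here refl) ℓ₁y≡0
    on-a-line {y} (inj₂ ℓ₂y≡0) = ∏-vanishes {ℓs = ℓ₁ ∷ ℓ₂ ∷ []} {y} (there (here refl)) ℓ₂y≡0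

  two-lines-isolating : ∀ {m} {a b c d e : Point F m} → ¬ Collinear a b c → ¬ d ≗ a → ¬ e ≗ a → ¬ e ≗ d →
    ∃ λ p → p ∈ a ∷ b ∷ c ∷ [] × ∃₂ λ ℓ₁ ℓ₂ → Isolates (ℓ₁ ∷ ℓ₂ ∷ []) p (a ∷ b ∷ c ∷ d ∷ e ∷ [])
  two-lines-isolating {a = a} {b} {c} {d} {e} ¬abc d≉a e≉a e≉d with collinear? a d e
  ... | no ¬ade =
    let ℓ₁ , ℓ₁b , ℓ₁c , ℓ₁a = separating-line ¬abc
        ℓ₂ , ℓ₂d , ℓ₂e , ℓ₂a = separating-line ¬ade
    in a , here refl , ℓ₁ , ℓ₂ , two-forms-isolating ℓ₁a ℓ₂a
         (inj₁ refl ∷ inj₂ (inj₁ ℓ₁b) ∷ inj₂ (inj₁ ℓ₁c) ∷ inj₂ (inj₂ ℓ₂d) ∷ inj₂ (inj₂ ℓ₂e) ∷ [])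
  ... | yes ade with collinear? a b d
  ... | yes abd =
    let -- otherwise a and c lie on the line de = ad, which also contains b
        ¬cde : ¬ Collinear c d e
        ¬cde cde = ¬abc (Collinear-trans d≉a (Collinear-swapʳ abd) (Collinear-swapˡ
                     (Collinear-trans e≉d (Collinear-swapʳ (Collinear-swapˡ ade)) (Collinear-swapʳ (Collinear-swapˡ cde)))))
        ℓ₁ , ℓ₁a , ℓ₁b , ℓ₁c = separating-line (¬abc ∘ Collinear-swapʳ ∘ Collinear-swapˡ)
        ℓ₂ , ℓ₂d , ℓ₂e , ℓ₂c = separating-line ¬cde
    in c , there (there (here refl)) , ℓ₁ , ℓ₂ , two-forms-isolating ℓ₁c ℓ₂c
         (inj₂ (inj₁ ℓ₁a) ∷ inj₂ (inj₁ ℓ₁b) ∷ inj₁ refl ∷ inj₂ (inj₂ ℓ₂d) ∷ inj₂ (inj₂ ℓ₂e) ∷ [])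
  ... | no ¬abd with collinear? a c e
  ... | no ¬ace =
    let ℓ₁ , ℓ₁b , ℓ₁d , ℓ₁a = separating-line ¬abd
        ℓ₂ , ℓ₂c , ℓ₂e , ℓ₂a = separating-line ¬ace
    in a , here refl , ℓ₁ , ℓ₂ , two-forms-isolating ℓ₁a ℓ₂a
         (inj₁ refl ∷ inj₂ (inj₁ ℓ₁b) ∷ inj₂ (inj₂ ℓ₂c) ∷ inj₂ (inj₁ ℓ₁d) ∷ inj₂ (inj₂ ℓ₂e) ∷ [])
  ... | yes ace =
    let adc : Collinear a d c
        adc = Collinear-trans e≉a (Collinear-swapʳ ade) (Collinear-swapʳ ace)
        -- otherwise a and b lie on the line de = ad, which also contains c
        ¬bde : ¬ Collinear b d e
        ¬bde bde = ¬abc (Collinear-trans d≉a (Collinear-swapˡ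
                     (Collinear-trans e≉d (Collinear-swapʳ (Collinear-swapˡ ade)) (Collinear-swapʳ (Collinear-swapˡ bde)))) adc)
        ℓ₁ , ℓ₁a , ℓ₁c , ℓ₁b = separating-line (¬abc ∘ Collinear-swapˡ)
        ℓ₂ , ℓ₂d , ℓ₂e , ℓ₂b = separating-line ¬bde
    in b , there (here refl) , ℓ₁ , ℓ₂ , two-forms-isolating ℓ₁b ℓ₂b
         (inj₂ (inj₁ ℓ₁a) ∷ inj₁ refl ∷ inj₂ (inj₁ ℓ₁c) ∷ inj₂ (inj₂ ℓ₂d) ∷ inj₂ (inj₂ ℓ₂e) ∷ [])

  ≉-sym : ∀ {m} {x y : Point F m} → ¬ x ≗ y → ¬ y ≗ x
  ≉-sym x≉y y≗x = x≉y (sym ∘ y≗x)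

  Distinct : ∀ {m} → List (Point F m) → Set
  Distinct = AllPairs (λ x y → ¬ x ≗ y)

  isolating-forms : ∀ {m} {a b c d e : Point F m} {rest} → ¬ Collinear a b c → Distinct (a ∷ b ∷ c ∷ d ∷ e ∷ rest) →
    ∃ λ p → p ∈ a ∷ b ∷ c ∷ [] × ∃ λ ℓs → length ℓs ≡ 2 ℕ.+ length rest × Isolates ℓs p (a ∷ b ∷ c ∷ d ∷ e ∷ rest)
  isolating-forms {rest = rest} ¬abc
    ((_ ∷ _ ∷ a≉d ∷ a≉e ∷ a≉rest) ∷ (_ ∷ _ ∷ _ ∷ b≉rest) ∷ (_ ∷ _ ∷ c≉rest) ∷ (d≉e ∷ _) ∷ _)
    with two-lines-isolating ¬abc (≉-sym a≉d) (≉-sym a≉e) (≉-sym d≉e)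
  ... | p , p∈abc , ℓ₁ , ℓ₂ , isolates₅ with hyperplanes-isolating p rest (All.lookup rest≉abc p∈abc)
    where
    rest≉abc = All.map ≉-sym a≉rest ∷ All.map ≉-sym b≉rest ∷ All.map ≉-sym c≉rest ∷ []
  ... | ℓs , length≡ , isolatesRest =
    p , p∈abc , ℓ₁ ∷ ℓ₂ ∷ ℓs , cong (2 ℕ.+_) length≡ , Isolates-++ {ℓs = ℓ₁ ∷ ℓ₂ ∷ []} {ℓs} isolates₅ isolatesRest

  noncollinear⇒degree-bound : ∀ m r (g : Poly F m) → DegAtMost F m r g → ∀ {a b c} T L → ¬ Collinear a b c →
    Distinct (a ∷ b ∷ c ∷ T) → All (λ x → evalPoly F m g x ≢ 0#) (a ∷ b ∷ c ∷ []) →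
    (∀ x → evalPoly F m g x ≢ 0# → Any (x ≗_) (a ∷ b ∷ c ∷ T)) → length T ≡ 2 ℕ.+ L →
    m ℕ.* (size ∸ 1) ≤ r ℕ.+ (2 ℕ.+ L)
  noncollinear⇒degree-bound m r g g≤r (d ∷ e ∷ rest) L ¬abc distinct abc≢0 covers length≡
    with isolating-forms {rest = rest} ¬abc distinct
  ... | p , p∈abc , ℓs , ℓs-length , ℓsp≢0 , isolates =
    subst (λ n → m ℕ.* (size ∸ 1) ≤ r ℕ.+ n) (trans ℓs-length (cong (2 ℕ.+_) (ℕ.suc-injective (ℕ.suc-injective length≡))))
      (isolating⇒degree-bound m r g g≤r p ℓs (All.lookup abc≢0 p∈abc) ℓsp≢0 vanishes)
    where
    vanishes : ∀ x → evalPoly F m g x ≢ 0# → ¬ x ≗ p → ∏ ℓs x ≡ 0#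
    vanishes x gx≢0 x≉p with All.lookupAny isolates (covers x gx≢0)
    ... | inj₁ refl , x≗p = ⊥-elim (x≉p x≗p)
    ... | inj₂ ℓsy≡0 , x≗y = trans (∏-resp ℓs x≗y) ℓsy≡0

  collinear⇒on-line : ∀ {m} {a b y : Point F m} k c → c * (b k - a k) ≡ 1# → Collinear a b y →
    ∀ i → y i ≡ a i + (c * (y k - a k)) * (b i - a i)
  collinear⇒on-line {a = a} {b} {y} k c c*dₖ≡1 aby i = sym (begin
    a i + (c * (y k - a k)) * (b i - a i)   ≡⟨ cong (a i +_) (solve 3 (λ c s t → (c :* s) :* t := c :* (t :* s)) refl c (y k - a k) (b i - a i)) ⟩
    a i + c * ((b i - a i) * (y k - a k))   ≡⟨ cong (λ t → a i + c * t) (aby k i) ⟨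
    a i + c * ((b k - a k) * (y i - a i))   ≡⟨ cong (a i +_) (*-assoc c _ _) ⟨
    a i + (c * (b k - a k)) * (y i - a i)   ≡⟨ cong (λ t → a i + t * (y i - a i)) c*dₖ≡1 ⟩
    a i + 1# * (y i - a i)                  ≡⟨ cong (a i +_) (*-identityˡ (y i - a i)) ⟩
    a i + (y i - a i)                       ≡⟨ solve 2 (λ s t → s :+ (t :- s) := t) refl (a i) (y i) ⟩
    y i                                     ∎)

  Collinear-refl₁ : ∀ {m} (a b : Point F m) → Collinear a b a
  Collinear-refl₁ a b i j = trans (cong ((b i - a i) *_) (-‿inverseʳ (a j)))
    (trans (zeroʳ _) (sym (trans (cong ((b j - a j) *_) (-‿inverseʳ (a i))) (zeroʳ _))))

  Collinear-refl₂ : ∀ {m} (a b : Point F m) → Collinear a b b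
  Collinear-refl₂ a b i j = *-comm (b i - a i) (b j - a j)

  collinear⇒SupportInLine : ∀ {m} (f : Fun F m) {a b : Point F m} S → ¬ a ≗ b → All (Collinear a b) S →
    (∀ x → f x ≢ 0# → Any (x ≗_) S) → SupportInLine F m f
  collinear⇒SupportInLine f {a} {b} S a≉b onLine covers = a , b ⊖ a , (k , dₖ≢0) , parameter
    where
    k = proj₁ (∃-coordinate-≢ (≉-sym a≉b))
    dₖ≢0 : b k - a k ≢ 0#
    dₖ≢0 = x≢y⇒x-y≢0 (proj₂ (∃-coordinate-≢ (≉-sym a≉b)))
    c = proj₁ (inverse (b k - a k) dₖ≢0)
    c*dₖ≡1 : c * (b k - a k) ≡ 1#
    c*dₖ≡1 = trans (*-comm c _) (proj₂ (inverse (b k - a k) dₖ≢0))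
    parameter : ∀ x → f x ≢ 0# → ∃ λ t → ∀ i → x i ≡ a i + t * (b i - a i)
    parameter x fx≢0 with All.lookupAny onLine (covers x fx≢0)
    ... | aby , x≗y = c * (Any.lookup (covers x fx≢0) k - a k) , λ i → trans (x≗y i) (collinear⇒on-line k c c*dₖ≡1 aby i)

  support-in-line : ∀ m r (g : Poly F m) → DegAtMost F m r g → (f : Fun F m) → (∀ x → f x ≡ evalPoly F m g x) →
    ∀ L (S : List (Point F m)) → Distinct S → All (λ x → f x ≢ 0#) S → (∀ x → f x ≢ 0# → Any (x ≗_) S) →
    length S ≡ 5 ℕ.+ L → r ℕ.+ (2 ℕ.+ L) < m ℕ.* (size ∸ 1) → SupportInLine F m f
  support-in-line m r g g≤r f f≗g L (a ∷ b ∷ T) ((a≉b ∷ a≉T) ∷ b≉T ∷ T-distinct) (fa≢0 ∷ fb≢0 ∷ fT≢0) covers length≡ budget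
    with All.all? (collinear? a b) T
  ... | yes abT = collinear⇒SupportInLine f (a ∷ b ∷ T) a≉b (Collinear-refl₁ a b ∷ Collinear-refl₂ a b ∷ abT) covers
  ... | no ¬abT = ⊥-elim (ℕ.<⇒≱ budget (noncollinear⇒degree-bound m r g g≤r (T Any.─ i) L (Any.lookup-result i)
          ((a≉b ∷ All-extract i a≉T) ∷ All-extract i b≉T ∷ AllPairs-extract ≉-sym i T-distinct)
          (All.map (λ {x} fx≢0 → fx≢0 ∘ trans (f≗g x)) (fa≢0 ∷ fb≢0 ∷ proj₁ (All.lookupAny fT≢0 i) ∷ []))
          (λ x gx≢0 → extract (covers x (gx≢0 ∘ trans (sym (f≗g x)))))
          (ℕ.suc-injective (trans (sym (List.length-removeAt′ T (Any.index i))) (ℕ.suc-injective (ℕ.suc-injective length≡))))))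
    where
    i = All.¬All⇒Any¬ (collinear? a b) T ¬abT
    extract : ∀ {x} → Any (x ≗_) (a ∷ b ∷ T) → Any (x ≗_) (a ∷ b ∷ Any.lookup i ∷ (T Any.─ i))
    extract (here x≗a) = here x≗a
    extract (there (here x≗b)) = there (here x≗b)
    extract (there (there x∈T)) = there (there (Any-extract i x∈T))

  Idx : ℕ → Set
  Idx m = Fin m → Fin size

  -- `allIdx` enumerates `Fin size` through a list local to its definition in Defs, which cannot be
  -- named here. Abstracting `map` lets unification expose it in `allIdx-step`; `localAllFin` then
  -- names it as a function of the clause variable m (which it ignores) and of the bound n.
  private
    allIdx-step : ∀ m → Σ (List (Fin size)) λ as → Σ (Fin size → Idx m → Idx (suc m)) λ g →
      (∀ a v → g a v ≗ a Vector.∷ v) × allIdx F (suc m) ≡ List.concatMap (λ a → List.map (g a) (allIdx F m)) as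
    allIdx-step m with List.map {A = Fin size} {B = List (Idx (suc m))}
    ... | map = _ , _ , (λ a v → λ { zero → refl ; (suc i) → refl }) , refl

    mutual
      localAllFin : ℕ → (n : ℕ) → List (Fin n)
      localAllFin = _

      allIdx-step-list : ∀ m → proj₁ (allIdx-step m) ≡ localAllFin m size
      allIdx-step-list m with size
      ... | n = refl

    localAllFin≡allFin : ∀ m n → localAllFin m n ≡ List.allFin n
    localAllFin≡allFin m zero = refl
    localAllFin≡allFin m (suc n) =
      cong (zero ∷_) (trans (cong (List.map suc) (localAllFin≡allFin m n)) (List.map-tabulate (λ i → i) suc))

  concatMap-map : ∀ {A B C : Set} (g : A → B → C) xs ys →
    List.concatMap (λ x → List.map (g x) ys) xs ≡ List.cartesianProductWith g xs ys
  concatMap-map g [] ys = refl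
  concatMap-map g (x ∷ xs) ys = cong (List.map (g x) ys List.++_) (concatMap-map g xs ys)

  allIdx-suc : ∀ m → ∃ λ (g : Fin size → Idx m → Idx (suc m)) → (∀ a v → g a v ≗ a Vector.∷ v) ×
    allIdx F (suc m) ≡ List.cartesianProductWith g (List.allFin size) (allIdx F m)
  allIdx-suc m = g , proj₁ (proj₂ (proj₂ step)) , trans (proj₂ (proj₂ (proj₂ step)))
    (trans (cong (List.concatMap (λ a → List.map (g a) (allIdx F m))) (trans (allIdx-step-list m) (localAllFin≡allFin m size)))
      (concatMap-map g (List.allFin size) (allIdx F m)))
    where
    step = allIdx-step m
    g = proj₁ (proj₂ step)

  allIdx-complete : ∀ m (w : Idx m) → Any (w ≗_) (allIdx F m)
  allIdx-complete zero w = here (λ ())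
  allIdx-complete (suc m) w with allIdx-suc m
  ... | g , g≗∷ , unfold = subst (Any (w ≗_)) (sym unfold) (Any.map (λ w′≗v i → trans (w≗w′ i) (w′≗v i))
        (∈-cartesianProductWith⁺ (≡.setoid (Fin size)) (Fin m ≡.→-setoid Fin size) (Fin (suc m) ≡.→-setoid Fin size)
          g-cong (∈-allFin (w zero)) (allIdx-complete m (Vector.tail w))))
    where
    w≗w′ : w ≗ g (w zero) (Vector.tail w)
    w≗w′ zero = sym (g≗∷ (w zero) (Vector.tail w) zero)
    w≗w′ (suc i) = sym (g≗∷ (w zero) (Vector.tail w) (suc i))
    g-cong : ∀ {a a′ v v′} → a ≡ a′ → v ≗ v′ → g a v ≗ g a′ v′
    g-cong {a} {a′} {v} {v′} refl v≗v′ zero = trans (g≗∷ a v zero) (sym (g≗∷ a v′ zero))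
    g-cong {a} {a′} {v} {v′} refl v≗v′ (suc i) = trans (g≗∷ a v (suc i)) (trans (v≗v′ i) (sym (g≗∷ a v′ (suc i))))

  allIdx-distinct : ∀ m → AllPairs (λ u v → ¬ u ≗ v) (allIdx F m)
  allIdx-distinct zero = [] ∷ []
  allIdx-distinct (suc m) with allIdx-suc m
  ... | g , g≗∷ , unfold = subst (AllPairs (λ u v → ¬ u ≗ v)) (sym unfold)
        (UniqueS.cartesianProductWith⁺ (≡.setoid (Fin size)) (Fin m ≡.→-setoid Fin size) (Fin (suc m) ≡.→-setoid Fin size)
          g g-injective (Unique.allFin⁺ size) (allIdx-distinct m))
    where
    g-injective : ∀ {a a′ v v′} → g a v ≗ g a′ v′ → a ≡ a′ × v ≗ v′
    g-injective {a} {a′} {v} {v′} gav≗ = trans (sym (g≗∷ a v zero)) (trans (gav≗ zero) (g≗∷ a′ v′ zero))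
      , λ i → trans (sym (g≗∷ a v (suc i))) (trans (gav≗ (suc i)) (g≗∷ a′ v′ (suc i)))

  toPoint : ∀ {m} → Idx m → Point F m
  toPoint v i = to (v i)

  support : ∀ m → Fun F m → List (Point F m)
  support m f = List.map toPoint (List.filter (λ v → ¬? (f (toPoint v) ≟ 0#)) (allIdx F m))

  length-support : ∀ m f → length (support m f) ≡ weight F m f
  length-support m f = List.length-map toPoint (List.filter (λ v → ¬? (f (toPoint v) ≟ 0#)) (allIdx F m))

  support-nonzero : ∀ m f → All (λ x → f x ≢ 0#) (support m f)
  support-nonzero m f = All.map⁺ (All.all-filter (λ v → ¬? (f (toPoint v) ≟ 0#)) (allIdx F m))

  support-distinct : ∀ m f → Distinct (support m f)
  support-distinct m f = AllPairs.map⁺ (AllPairs.map (λ u≉v toU≗toV → u≉v (λ i → to-injective (toU≗toV i)))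
    (AllPairs.filter⁺ (λ v → ¬? (f (toPoint v) ≟ 0#)) (allIdx-distinct m)))

  support-complete : ∀ m f → Respects≗ f → ∀ x → f x ≢ 0# → Any (x ≗_) (support m f)
  support-complete m f resp x fx≢0 = from-filter (Any.filter⁺ nonzero? x∈allIdx)
    where
    nonzero? = λ v → ¬? (f (toPoint v) ≟ 0#)
    x∈allIdx : Any (λ v → x ≗ toPoint v) (allIdx F m)
    x∈allIdx = Any.map (λ w≗v i → trans (sym (Inverse.strictlyInverseˡ enum (x i))) (cong to (w≗v i)))
      (allIdx-complete m (Inverse.from enum ∘ x))
    from-filter : Any (λ v → x ≗ toPoint v) (List.filter nonzero? (allIdx F m)) ⊎ ¬ f (toPoint (Any.lookup x∈allIdx)) ≢ 0# →
      Any (x ≗_) (support m f)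
    from-filter (inj₁ x∈) = Any.map⁺ x∈
    from-filter (inj₂ ¬fy≢0) = ⊥-elim (¬fy≢0 (fx≢0 ∘ trans (resp (Any.lookup-result x∈allIdx))))

theorem2p1 : (F : FiniteField) → (m s : ℕ) →
    2 ≤ m → 5 ≤ FiniteField.size F → 1 ≤ s → s ≤ FiniteField.size F ∸ 4 →
    (f : Fun F m) →
    InRM F ((m ∸ 1) ℕ.* (FiniteField.size F ∸ 1) ℕ.+ s) m f →
    weight F m f ≡ (FiniteField.size F ∸ s) ℕ.+ 1 →
    SupportInLine F m f
theorem2p1 F m s 2≤m 5≤q _ s≤q∸4 f (g , _ , g≤r , f≗g) |f|≡ =
  support-in-line F m r g g≤r f f≗g (q ∸ s ∸ 4) (support F m f) (support-distinct F m f) (support-nonzero F m f)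
    (support-complete F m f f-resp) (trans (length-support F m f) (trans |f|≡ (q∸s+1≡5+[q∸s∸4] 4≤q s≤q∸4)))
    (degree-budget m q s (ℕ.≤-trans (s≤s z≤n) 2≤m) 4≤q s≤q∸4)
  where
  q = FiniteField.size F
  r = (m ∸ 1) ℕ.* (q ∸ 1) ℕ.+ s
  4≤q : 4 ≤ q
  4≤q = ℕ.≤-trans (ℕ.n≤1+n 4) 5≤q
  f-resp : Respects≗ F f
  f-resp {x} {y} x≗y = trans (f≗g x) (trans (evalPoly-resp F m g x≗y) (sym (f≗g y)))
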